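{- Let $H$ be a simple $k$-uniform hypergraph with $n$ vertices and more than one edge. Then in the burning distribution of $H$, $P_1=\emptyset$ and $P_n=\left(1-\frac{1}{k},1\right)$.
   Context: A hypergraph $H=(V(H),E(H))$ has a finite nonempty vertex set and a finite collection $E(H)$ of subsets of $V(H)$ called edges; it is $k$-uniform if every edge has exactly $k$ vertices, and simple if no edge is repeated and no edge has at most one vertex. For a proportion $p\in(0,1)$, the proportion-based propagation rule is: if at the end of a round at least $\lceil p|e|\rceil$ vertices of an edge $e$ are on fire, then in the next round all vertices of $e$ catch fire; burned vertices stay burned. Burning game: let $F_0=\emptyset$ and $F_r$ be the set of burned vertices at the end of round $r$. In each round $r\geq 1$, simultaneously, vertices catch fire by propagation from $F_{r-1}$ (no propagation in round 1), and a player chooses a vertex $u_r\notin F_{r-1}$ (a source) and sets it on fire. A burning sequence is a sequence $(u_1,\ldots,u_k)$ of such sources after which every vertex is on fire at the end of round $k$; $b_p(H)$ is the minimum length of a burning sequence. The burning distribution of $H$ is the partition of $(0,1)$ into the sets $P_j=\{p\in(0,1): b_p(H)=j\}$, $j=1,\ldots,n$.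
   Formalization: The proportion p ranges only over the rationals in $(0,1)$. -}

module Defs where

open import Data.Nat using (ℕ; _≤_; _<_)
open import Data.Integer using (ℤ; +_) renaming (_≤?_ to _≤ℤ?_)
open import Data.Rational using (ℚ; _/_; _*_; ceiling)
open import Data.Fin using (Fin)
open import Data.Fin.Subset using (Subset; _∪_; _∩_; ∣_∣; ⁅_⁆; _∉_; ⊤; ⊥)
open import Data.List using (List; []; _∷_; length; foldr)
open import Data.List.Relation.Unary.All using (All)
open import Data.List.Relation.Unary.Unique.Propositional using (Unique)
open import Data.Bool using (if_then_else_)
open import Data.Product using (Σ; _×_; ∃)
open import Data.Unit using () renaming (⊤ to Unit)
open import Relation.Nullary using (does)
open import Relation.Binary.PropositionalEquality using (_≡_)

Hypergraph : ℕ → Set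
Hypergraph n = List (Subset n)

Uniform : ∀ {n} → ℕ → Hypergraph n → Set
Uniform k E = All (λ e → ∣ e ∣ ≡ k) E

Simple : ∀ {n} → Hypergraph n → Set
Simple E = Unique E × All (λ e → 2 ≤ ∣ e ∣) E

ignites : ∀ {n} → ℚ → Subset n → Subset n → Data.Bool.Bool
ignites p F e = does (ceiling (p * (+ ∣ e ∣ / 1)) ≤ℤ? + ∣ e ∩ F ∣)
  where import Data.Bool

propagate : ∀ {n} → ℚ → Hypergraph n → Subset n → Subset n
propagate p E F = foldr (λ e acc → if ignites p F e then e ∪ acc else acc) F E

step : ∀ {n} → ℚ → Hypergraph n → Subset n → Fin n → Subset n
step p E F u = propagate p E F ∪ ⁅ u ⁆

runFrom : ∀ {n} → ℚ → Hypergraph n → Subset n → List (Fin n) → Subset n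
runFrom p E F [] = F
runFrom p E F (u ∷ us) = runFrom p E (step p E F u) us

ValidFrom : ∀ {n} → ℚ → Hypergraph n → Subset n → List (Fin n) → Set
ValidFrom p E F [] = Unit
ValidFrom p E F (u ∷ us) = (u ∉ F) × ValidFrom p E (step p E F u) us

-- F_k after playing the sources (round 1: no propagation, F_1 = {u_1})
burned : ∀ {n} → ℚ → Hypergraph n → List (Fin n) → Subset n
burned p E [] = ⊥
burned p E (u ∷ us) = runFrom p E ⁅ u ⁆ us

-- legal sources (u_1 ∉ F_0 = ∅ is automatic)
Legal : ∀ {n} → ℚ → Hypergraph n → List (Fin n) → Set
Legal p E [] = Unit
Legal p E (u ∷ us) = ValidFrom p E ⁅ u ⁆ us

IsBurningSeq : ∀ {n} → ℚ → Hypergraph n → List (Fin n) → Set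
IsBurningSeq p E us = Legal p E us × burned p E us ≡ ⊤

BurningNumber : ∀ {n} → ℚ → Hypergraph n → ℕ → Set
BurningNumber p E j =
  (∃ λ us → length us ≡ j × IsBurningSeq p E us)
  × (∀ us → IsBurningSeq p E us → j ≤ length us)

{-# OPTIONS --safe #-}
-- Every round burns at least one new vertex, so b_p(H) ≤ n, and b_p(H) < n as soon as some
-- legal play burns two new vertices in one round.  For an edge of size k the ignition
-- threshold ⌈pk⌉ equals k precisely when p > 1 - 1/k: then an edge ignites only once it is
-- already burned, propagation is idle and every burning sequence has length n.
-- If p ≤ 1 - 1/k, then ⌈pk⌉ ≤ k - 1: burn the vertices of an edge e one per round (if
-- propagation ever adds a vertex, that round already gains); once k - 1 of them burn, e
-- ignites, and together with a source outside e (which exists because a second edge of the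
-- same size differs from e) one round burns two new vertices, so some burning sequence is
-- shorter than n.  Finally P_1 = ∅ because a single source burns one vertex while n ≥ 2.
module Submission where

open import Defs
open import Data.Nat using (ℕ; _≤_; NonZero)
open import Data.Integer using (+_)
open import Data.Rational using (ℚ; _<_; _-_; _/_; 0ℚ; 1ℚ)
open import Data.List using (length)
open import Data.Product using (_×_)
open import Relation.Nullary using (¬_)
open import Function.Bundles using (_⇔_)

open import Data.Nat as ℕ using (suc; zero; _+_; _∸_; z≤n; s≤s)
import Data.Nat.Properties as ℕ
open import Data.Integer as ℤ using (ℤ; -[1+_]; +[1+_]; _/ℕ_)
import Data.Integer.Properties as ℤ
open import Data.Integer.DivMod using ([n/ℕd]*d≤n; n<s[n/ℕd]*d)
open import Data.Rational as ℚ using (mkℚ; _*_; ↥_; ↧_; ↧ₙ_; ceiling; toℚᵘ)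
import Data.Rational.Properties as ℚ
open import Data.Rational.Unnormalised as ℚᵘ using (mkℚᵘ; *≤*; *≡*)
import Data.Rational.Unnormalised.Properties as ℚᵘ
open import Data.Bool using (true; false; if_then_else_)
open import Data.Fin using (Fin)
open import Data.Vec using ([]; _∷_)
open import Data.Fin.Properties using (any?)
open import Data.Fin.Subset
  using (Subset; Nonempty; inside; outside; _∈_; _∉_; _⊆_; _∪_; _∩_; ⁅_⁆; ∣_∣; ⊤; ⊥)
open import Data.Fin.Subset.Properties
  using (_∈?_; nonempty?; Empty-unique; ⊆-antisym; ⊆-trans; ⊆⊤; p⊂q⇒∣p∣<∣q∣; p⊆q⇒∣p∣≤∣q∣;
         p⊆p∪q; q⊆p∪q; x∈p∪q⁻; p∩q⊆p; p∩q⊆q; x∈p∩q⁺; x∈⁅x⁆; x∈⁅y⁆⇒x≡y;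
         ∣⁅x⁆∣≡1; ∣⊤∣≡n; ∣⊥∣≡0; ∣p∣≤n; ∣p∣≡n⇒p≡⊤)
open import Data.List using (List; []; _∷_; _++_)
import Data.List.Properties as List
import Data.List.Membership.Propositional as List
open import Data.List.Relation.Unary.All using (All; []; _∷_)
import Data.List.Relation.Unary.All as All
open import Data.List.Relation.Unary.Any using (here; there)
open import Data.List.Relation.Unary.AllPairs using (_∷_)
open import Data.Product using (∃; _,_)
open import Data.Sum using (_⊎_; inj₁; inj₂; [_,_]′)
open import Data.Empty using (⊥-elim)
open import Function using (_∘_; id; mk⇔; Equivalence)
open import Function.Construct.Composition using (_⇔-∘_)
open import Function.Construct.Symmetry using (⇔-sym)
open import Relation.Nullary using (yes; no; ¬?; _×-dec_)
open import Relation.Nullary.Decidable using (dec-true; decidable-stable; proof)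
open import Relation.Nullary.Reflects using (Reflects; invert)
open import Relation.Binary.PropositionalEquality

m≤n/ℕd⇔m*d≤n : ∀ m n d .{{_ : ℕ.NonZero d}} → m ℤ.≤ n /ℕ d ⇔ m ℤ.* + d ℤ.≤ n
m≤n/ℕd⇔m*d≤n m n d = mk⇔
  (λ m≤n/d → ℤ.≤-trans (ℤ.*-monoʳ-≤-nonNeg (+ d) m≤n/d) ([n/ℕd]*d≤n n d))
  (λ md≤n → ℤ.≮⇒≥ λ n/d<m → ℤ.<-irrefl refl (ℤ.<-≤-trans (n<s[n/ℕd]*d n d)
    (ℤ.≤-trans (ℤ.*-monoʳ-≤-nonNeg (+ d) (ℤ.i<j⇒suc[i]≤j n/d<m)) md≤n)))

ceiling≡-[-↥x/ℕ↧x] : ∀ x → ceiling x ≡ ℤ.- ((ℤ.- ↥ x) /ℕ ↧ₙ x)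
ceiling≡-[-↥x/ℕ↧x] (mkℚ (+ 0) d _) = refl
ceiling≡-[-↥x/ℕ↧x] (mkℚ +[1+ n ] d _) = cong ℤ.-_ (ℤ.*-identityˡ (-[1+ n ] /ℕ suc d))
ceiling≡-[-↥x/ℕ↧x] (mkℚ -[1+ n ] d _) = cong ℤ.-_ (ℤ.*-identityˡ (+[1+ n ] /ℕ suc d))

ceiling[x]≤c⇔↥x≤c*↧x : ∀ x c → ceiling x ℤ.≤ c ⇔ ↥ x ℤ.≤ c ℤ.* ↧ x
ceiling[x]≤c⇔↥x≤c*↧x x@(mkℚ a d _) c = mk⇔ to from
  where
  q : ℤ
  q = (ℤ.- a) /ℕ suc d
  open Equivalence (m≤n/ℕd⇔m*d≤n (ℤ.- c) (ℤ.- a) (suc d))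
    renaming (to to ≤/ℕ⇒*≤; from to *≤⇒≤/ℕ)
  -c*D≡-[c*D] : ℤ.- c ℤ.* ↧ x ≡ ℤ.- (c ℤ.* ↧ x)
  -c*D≡-[c*D] = sym (ℤ.neg-distribˡ-* c (↧ x))
  to : ceiling x ℤ.≤ c → a ℤ.≤ c ℤ.* ↧ x
  to ⌈x⌉≤c = ℤ.neg-cancel-≤ (subst (ℤ._≤ ℤ.- a) -c*D≡-[c*D] (≤/ℕ⇒*≤ -c≤q))
    where
    -c≤q : ℤ.- c ℤ.≤ q
    -c≤q = subst (ℤ.- c ℤ.≤_) (ℤ.neg-involutive q)
      (ℤ.neg-mono-≤ (subst (ℤ._≤ c) (ceiling≡-[-↥x/ℕ↧x] x) ⌈x⌉≤c))
  from : a ℤ.≤ c ℤ.* ↧ x → ceiling x ℤ.≤ c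
  from a≤cD = subst₂ ℤ._≤_ (sym (ceiling≡-[-↥x/ℕ↧x] x)) (ℤ.neg-involutive c)
    (ℤ.neg-mono-≤ (*≤⇒≤/ℕ (subst (ℤ._≤ ℤ.- a) (sym -c*D≡-[c*D]) (ℤ.neg-mono-≤ a≤cD))))

toℚᵘ[c/1]≃c : ∀ c → toℚᵘ (c / 1) ℚᵘ.≃ mkℚᵘ c 0
toℚᵘ[c/1]≃c c = ℚ.toℚᵘ-fromℚᵘ (mkℚᵘ c 0)

x≤c/1⇔↥x≤c*↧x : ∀ x c → x ℚ.≤ c / 1 ⇔ ↥ x ℤ.≤ c ℤ.* ↧ x
x≤c/1⇔↥x≤c*↧x x@(mkℚ a _ _) c = mk⇔
  (λ x≤c → subst (ℤ._≤ c ℤ.* ↧ x) (ℤ.*-identityʳ a)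
    (ℚᵘ.drop-*≤* (ℚᵘ.≤-respʳ-≃ (toℚᵘ[c/1]≃c c) (ℚ.toℚᵘ-mono-≤ x≤c))))
  (λ a≤cD → ℚ.toℚᵘ-cancel-≤ (ℚᵘ.≤-respʳ-≃ (ℚᵘ.≃-sym (toℚᵘ[c/1]≃c c))
    (*≤* (subst (ℤ._≤ c ℤ.* ↧ x) (sym (ℤ.*-identityʳ a)) a≤cD))))

ceiling[x]≤c⇔x≤c/1 : ∀ x c → ceiling x ℤ.≤ c ⇔ x ℚ.≤ c / 1
ceiling[x]≤c⇔x≤c/1 x c = ⇔-sym (x≤c/1⇔↥x≤c*↧x x c) ⇔-∘ ceiling[x]≤c⇔↥x≤c*↧x x c

module _ (j : ℕ) where
  private
    k : ℚ
    k = + suc j / 1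
    instance
      k-pos : ℚ.Positive k
      k-pos = ℚ.normalize-pos (suc j) 1
      k-nonNeg : ℚ.NonNegative k
      k-nonNeg = ℚ.pos⇒nonNeg k

  1/k*k≡1 : (+ 1 / suc j) * k ≡ 1ℚ
  1/k*k≡1 = ℚ.toℚᵘ-injective (begin
    toℚᵘ ((+ 1 / suc j) * k)                       ≈⟨ ℚ.toℚᵘ-homo-* (+ 1 / suc j) k ⟩
    toℚᵘ (+ 1 / suc j) ℚᵘ.* toℚᵘ k                 ≈⟨ ℚᵘ.*-cong (ℚ.toℚᵘ-fromℚᵘ (mkℚᵘ (+ 1) j))
                                                                 (toℚᵘ[c/1]≃c (+ suc j)) ⟩
    ℚᵘ.1/ mkℚᵘ (+ suc j) 0 ℚᵘ.* mkℚᵘ (+ suc j) 0  ≈⟨ ℚᵘ.*-inverseˡ (mkℚᵘ (+ suc j) 0) ⟩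
    ℚᵘ.1ℚᵘ                                         ∎)
    where open ℚᵘ.≃-Reasoning

  k≡[k-1]+1 : k ≡ + j / 1 ℚ.+ 1ℚ
  k≡[k-1]+1 = ℚ.toℚᵘ-injective (begin
    toℚᵘ k                              ≈⟨ toℚᵘ[c/1]≃c (+ suc j) ⟩
    mkℚᵘ (+ suc j) 0                    ≈⟨ *≡* integral ⟩
    mkℚᵘ (+ j) 0 ℚᵘ.+ ℚᵘ.1ℚᵘ            ≈⟨ ℚᵘ.+-congˡ ℚᵘ.1ℚᵘ (toℚᵘ[c/1]≃c (+ j)) ⟨
    toℚᵘ (+ j / 1) ℚᵘ.+ toℚᵘ 1ℚ         ≈⟨ ℚ.toℚᵘ-homo-+ (+ j / 1) 1ℚ ⟨
    toℚᵘ (+ j / 1 ℚ.+ 1ℚ)               ∎)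
    where
    open ℚᵘ.≃-Reasoning
    integral : + suc j ℤ.* + 1 ≡ (+ j ℤ.* + 1 ℤ.+ + 1) ℤ.* + 1
    integral = trans (ℤ.*-identityʳ (+ suc j)) (trans (cong +_ (ℕ.+-comm 1 j))
      (sym (trans (ℤ.*-identityʳ _) (cong (ℤ._+ + 1) (ℤ.*-identityʳ (+ j))))))

  [1-1/k]*k≡k-1 : (1ℚ - + 1 / suc j) * k ≡ + j / 1
  [1-1/k]*k≡k-1 = begin
    (1ℚ - u) * k          ≡⟨ ℚ.*-distribʳ-+ k 1ℚ (ℚ.- u) ⟩
    1ℚ * k ℚ.+ ℚ.- u * k  ≡⟨ cong₂ ℚ._+_ (ℚ.*-identityˡ k) (sym (ℚ.neg-distribˡ-* u k)) ⟩
    k - u * k             ≡⟨ cong (k -_) 1/k*k≡1 ⟩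
    k - 1ℚ                ≡⟨ cong (_- 1ℚ) k≡[k-1]+1 ⟩
    + j / 1 ℚ.+ 1ℚ - 1ℚ   ≡⟨ ℚ.+-assoc (+ j / 1) 1ℚ (ℚ.- 1ℚ) ⟩
    + j / 1 ℚ.+ (1ℚ - 1ℚ) ≡⟨ cong (+ j / 1 ℚ.+_) (ℚ.+-inverseʳ 1ℚ) ⟩
    + j / 1 ℚ.+ ℚ.0ℚ      ≡⟨ ℚ.+-identityʳ (+ j / 1) ⟩
    + j / 1               ∎
    where
    open ≡-Reasoning
    u = + 1 / suc j

  p≤1-1/k⇒⌈p*k⌉≤k-1 : ∀ p → p ℚ.≤ 1ℚ - + 1 / suc j → ceiling (p * (+ suc j / 1)) ℤ.≤ + j
  p≤1-1/k⇒⌈p*k⌉≤k-1 p p≤1-1/k = Equivalence.from (ceiling[x]≤c⇔x≤c/1 (p * k) (+ j))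
    (ℚ.≤-trans (ℚ.*-monoʳ-≤-nonNeg k p≤1-1/k) (ℚ.≤-reflexive [1-1/k]*k≡k-1))

  1-1/k<p⇒k≤⌈p*k⌉ : ∀ p → 1ℚ - + 1 / suc j < p → + suc j ℤ.≤ ceiling (p * (+ suc j / 1))
  1-1/k<p⇒k≤⌈p*k⌉ p 1-1/k<p = ℤ.i<j⇒suc[i]≤j (ℤ.≰⇒> λ ⌈p*k⌉≤k-1 → ℚ.<-irrefl refl (ℚ.<-≤-trans 1-1/k<p
    (ℚ.*-cancelʳ-≤-pos k (ℚ.≤-trans (Equivalence.to (ceiling[x]≤c⇔x≤c/1 (p * k) (+ j)) ⌈p*k⌉≤k-1)
      (ℚ.≤-reflexive (sym [1-1/k]*k≡k-1))))))

private variable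
  n : ℕ
  p q r : Subset n
  x : Fin n

∣p∪q∣≤∣p∣+∣q∣ : ∀ (p q : Subset n) → ∣ p ∪ q ∣ ≤ ∣ p ∣ + ∣ q ∣
∣p∪q∣≤∣p∣+∣q∣ []            []            = z≤n
∣p∪q∣≤∣p∣+∣q∣ (outside ∷ p) (outside ∷ q) = ∣p∪q∣≤∣p∣+∣q∣ p q
∣p∪q∣≤∣p∣+∣q∣ (inside  ∷ p) (outside ∷ q) = s≤s (∣p∪q∣≤∣p∣+∣q∣ p q)
∣p∪q∣≤∣p∣+∣q∣ (outside ∷ p) (inside  ∷ q) =
  subst (suc ∣ p ∪ q ∣ ≤_) (sym (ℕ.+-suc ∣ p ∣ ∣ q ∣)) (s≤s (∣p∪q∣≤∣p∣+∣q∣ p q))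
∣p∪q∣≤∣p∣+∣q∣ (inside  ∷ p) (inside  ∷ q) =
  s≤s (ℕ.≤-trans (∣p∪q∣≤∣p∣+∣q∣ p q) (ℕ.+-monoʳ-≤ ∣ p ∣ (ℕ.n≤1+n ∣ q ∣)))

p⊆q⊎x∈p∖q : ∀ (p q : Subset n) → p ⊆ q ⊎ ∃ λ x → x ∈ p × x ∉ q
p⊆q⊎x∈p∖q p q with any? (λ x → x ∈? p ×-dec ¬? (x ∈? q))
... | yes x∈p∖q = inj₂ x∈p∖q
... | no  ∄x∈p∖q = inj₁ λ {x} x∈p → decidable-stable (x ∈? q) λ x∉q → ∄x∈p∖q (x , x∈p , x∉q)

⊆⇒≡⊎∣∣< : p ⊆ q → p ≡ q ⊎ ∣ p ∣ ℕ.< ∣ q ∣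
⊆⇒≡⊎∣∣< {p = p} {q = q} p⊆q with p⊆q⊎x∈p∖q q p
... | inj₁ q⊆p              = inj₁ (⊆-antisym p⊆q q⊆p)
... | inj₂ (x , x∈q , x∉p) = inj₂ (p⊂q⇒∣p∣<∣q∣ (p⊆q , x , x∈q , x∉p))

∣p∣≤∣p∩q∣⇒p⊆q : ∣ p ∣ ≤ ∣ p ∩ q ∣ → p ⊆ q
∣p∣≤∣p∩q∣⇒p⊆q {p = p} {q = q} ∣p∣≤∣p∩q∣ with ⊆⇒≡⊎∣∣< (p∩q⊆p p q)
... | inj₁ p∩q≡p    = subst (_⊆ q) p∩q≡p (p∩q⊆q p q)
... | inj₂ ∣p∩q∣<∣p∣ = ⊥-elim (ℕ.<⇒≱ ∣p∩q∣<∣p∣ ∣p∣≤∣p∩q∣)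

0<∣p∣⇒Nonempty : ∀ {n} {p : Subset n} → 0 ℕ.< ∣ p ∣ → Nonempty p
0<∣p∣⇒Nonempty {n} {p} 0<∣p∣ = decidable-stable (nonempty? p) λ p-empty →
  ℕ.<⇒≢ 0<∣p∣ (sym (trans (cong ∣_∣ (Empty-unique p-empty)) (∣⊥∣≡0 n)))

p≢q∧∣p∣≡∣q∣⇒∃x∉p : p ≢ q → ∣ p ∣ ≡ ∣ q ∣ → ∃ λ x → x ∉ p
p≢q∧∣p∣≡∣q∣⇒∃x∉p {p = p} {q = q} p≢q ∣p∣≡∣q∣ with p⊆q⊎x∈p∖q ⊤ p
... | inj₂ (x , _ , x∉p) = x , x∉p
... | inj₁ ⊤⊆p = ⊥-elim (p≢q (trans p≡⊤ (sym q≡⊤)))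
  where
  p≡⊤ : p ≡ ⊤
  p≡⊤ = ⊆-antisym ⊆⊤ ⊤⊆p
  q≡⊤ : q ≡ ⊤
  q≡⊤ = ∣p∣≡n⇒p≡⊤ (trans (sym ∣p∣≡∣q∣) (trans (cong ∣_∣ p≡⊤) (∣⊤∣≡n _)))

∣p∣<∣q∣⇒∃x∈q∖p : ∣ p ∣ ℕ.< ∣ q ∣ → ∃ λ x → x ∈ q × x ∉ p
∣p∣<∣q∣⇒∃x∈q∖p {p = p} {q = q} ∣p∣<∣q∣ =
  [ (λ (q⊆p : q ⊆ p) → ⊥-elim (ℕ.<⇒≱ ∣p∣<∣q∣ (p⊆q⇒∣p∣≤∣q∣ q⊆p))) , id ]′ (p⊆q⊎x∈p∖q q p)

∪-lub : p ⊆ r → q ⊆ r → p ∪ q ⊆ r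
∪-lub {p = p} {q = q} p⊆r q⊆r x∈p∪q = [ p⊆r , q⊆r ]′ (x∈p∪q⁻ p q x∈p∪q)

x∈p⇒⁅x⁆⊆p : x ∈ p → ⁅ x ⁆ ⊆ p
x∈p⇒⁅x⁆⊆p {x = x} {p = p} x∈p y∈⁅x⁆ = subst (_∈ p) (sym (x∈⁅y⁆⇒x≡y x y∈⁅x⁆)) x∈p

∣p∪⁅x⁆∣≡1+∣p∣ : x ∉ p → ∣ p ∪ ⁅ x ⁆ ∣ ≡ suc ∣ p ∣
∣p∪⁅x⁆∣≡1+∣p∣ {x = x} {p = p} x∉p = ℕ.≤-antisym
  (subst (∣ p ∪ ⁅ x ⁆ ∣ ≤_) (trans (ℕ.+-comm ∣ p ∣ ∣ ⁅ x ⁆ ∣) (cong (_+ ∣ p ∣) (∣⁅x⁆∣≡1 x)))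
    (∣p∪q∣≤∣p∣+∣q∣ p ⁅ x ⁆))
  (p⊂q⇒∣p∣<∣q∣ (p⊆p∪q ⁅ x ⁆ , x , q⊆p∪q p ⁅ x ⁆ (x∈⁅x⁆ x) , x∉p))

module _ (p : ℚ) where

  ignites⇔ : ∀ (F e : Subset n) →
             ignites p F e ≡ true ⇔ ceiling (p * (+ ∣ e ∣ / 1)) ℤ.≤ + ∣ e ∩ F ∣
  ignites⇔ F e = mk⇔ (λ does≡true → invert (subst (Reflects _) does≡true (proof ⌈p*∣e∣⌉≤?∣e∩F∣)))
                     (dec-true ⌈p*∣e∣⌉≤?∣e∩F∣)
    where ⌈p*∣e∣⌉≤?∣e∩F∣ = ceiling (p * (+ ∣ e ∣ / 1)) ℤ.≤? + ∣ e ∩ F ∣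

  propagate⊆propagate-∷ : ∀ e (E : Hypergraph n) F → propagate p E F ⊆ propagate p (e ∷ E) F
  propagate⊆propagate-∷ e E F with ignites p F e
  ... | true  = q⊆p∪q e _
  ... | false = λ x∈ → x∈

  ⊆propagate : ∀ (E : Hypergraph n) F → F ⊆ propagate p E F
  ⊆propagate []      F = λ x∈F → x∈F
  ⊆propagate (e ∷ E) F = ⊆-trans (⊆propagate E F) (propagate⊆propagate-∷ e E F)

  ignites⇒⊆propagate : ∀ {E : Hypergraph n} {e F} → e List.∈ E → ignites p F e ≡ true →
                       e ⊆ propagate p E F
  ignites⇒⊆propagate {E = e ∷ E} {F = F} (here refl) ignites≡true =
    subst (λ b → e ⊆ (if b then e ∪ propagate p E F else propagate p E F)) (sym ignites≡true) (p⊆p∪q _)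
  ignites⇒⊆propagate {E = e′ ∷ E} {F = F} (there e∈E) ignites≡true =
    ⊆-trans (ignites⇒⊆propagate e∈E ignites≡true) (propagate⊆propagate-∷ e′ E F)

  propagate⊆ : ∀ (E : Hypergraph n) F → All (λ e → ignites p F e ≡ true → e ⊆ F) E →
               propagate p E F ⊆ F
  propagate⊆ []      F []                       x∈F = x∈F
  propagate⊆ (e ∷ E) F (e-ignites⇒e⊆F ∷ rest) with ignites p F e
  ... | true  = ∪-lub (e-ignites⇒e⊆F refl) (propagate⊆ E F rest)
  ... | false = propagate⊆ E F rest

module _ (p : ℚ) (E : Hypergraph n) where

  ∪⁅x⁆⊆step : ∀ F x → F ∪ ⁅ x ⁆ ⊆ step p E F x
  ∪⁅x⁆⊆step F x = ∪-lub (⊆-trans (⊆propagate p E F) (p⊆p∪q ⁅ x ⁆)) (q⊆p∪q _ ⁅ x ⁆)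

  step-grows : ∀ {F x} → x ∉ F → suc ∣ F ∣ ≤ ∣ step p E F x ∣
  step-grows {F} {x} x∉F = subst (_≤ ∣ step p E F x ∣) (∣p∪⁅x⁆∣≡1+∣p∣ x∉F) (p⊆q⇒∣p∣≤∣q∣ (∪⁅x⁆⊆step F x))

  runFrom-++ : ∀ F us vs → runFrom p E F (us ++ vs) ≡ runFrom p E (runFrom p E F us) vs
  runFrom-++ F []       vs = refl
  runFrom-++ F (u ∷ us) vs = runFrom-++ (step p E F u) us vs

  ValidFrom-++ : ∀ F us vs → ValidFrom p E F us → ValidFrom p E (runFrom p E F us) vs →
                 ValidFrom p E F (us ++ vs)
  ValidFrom-++ F []       vs _            valid-vs = valid-vs
  ValidFrom-++ F (u ∷ us) vs (u∉F , valid) valid-vs =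
    u∉F , ValidFrom-++ (step p E F u) us vs valid valid-vs

  Finish : Subset n → Set
  Finish F = ∃ λ us → ValidFrom p E F us × runFrom p E F us ≡ ⊤ × ∣ F ∣ + length us ≤ n

  finish-now : ∀ {F} → F ≡ ⊤ → Finish F
  finish-now {F} F≡⊤ = [] , _ , F≡⊤ , subst (_≤ n) (sym (ℕ.+-identityʳ ∣ F ∣)) (∣p∣≤n F)

  finish-later : ∀ {F x} → x ∉ F → Finish (step p E F x) → Finish F
  finish-later {F} {x} x∉F (us , valid , burns , ∣F′∣+∣us∣≤n) = x ∷ us , (x∉F , valid) , burns , (begin
    (∣ F ∣ + suc (length us))         ≡⟨ ℕ.+-suc ∣ F ∣ (length us) ⟩
    (suc ∣ F ∣ + length us)           ≤⟨ ℕ.+-monoˡ-≤ (length us) (step-grows x∉F) ⟩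
    (∣ step p E F x ∣ + length us)    ≤⟨ ∣F′∣+∣us∣≤n ⟩
    n                                 ∎)
    where open ℕ.≤-Reasoning

  finish : ∀ F → Finish F
  finish F = within (n ∸ ∣ F ∣) F (ℕ.m≤n+m∸n n ∣ F ∣)
    where
    within : ∀ t F → n ≤ ∣ F ∣ + t → Finish F
    within zero F n≤∣F∣+0 =
      finish-now (∣p∣≡n⇒p≡⊤ (ℕ.≤-antisym (∣p∣≤n F) (subst (n ≤_) (ℕ.+-identityʳ ∣ F ∣) n≤∣F∣+0)))
    within (suc t) F n≤∣F∣+1+t with p⊆q⊎x∈p∖q ⊤ F
    ... | inj₁ ⊤⊆F              = finish-now (⊆-antisym ⊆⊤ ⊤⊆F)
    ... | inj₂ (x , _ , x∉F) = finish-later x∉F (within t (step p E F x) (begin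
        n                      ≤⟨ n≤∣F∣+1+t ⟩
        (∣ F ∣ + suc t)        ≡⟨ ℕ.+-suc ∣ F ∣ t ⟩
        (suc ∣ F ∣ + t)        ≤⟨ ℕ.+-monoˡ-≤ t (step-grows x∉F) ⟩
        (∣ step p E F x ∣ + t) ∎))
      where open ℕ.≤-Reasoning

  Inert : Set
  Inert = ∀ F → propagate p E F ⊆ F

  module _ (inert : Inert) where

    inert⇒∣runFrom∣≤ : ∀ F us → ∣ runFrom p E F us ∣ ≤ ∣ F ∣ + length us
    inert⇒∣runFrom∣≤ F []       = ℕ.≤-reflexive (sym (ℕ.+-identityʳ ∣ F ∣))
    inert⇒∣runFrom∣≤ F (x ∷ us) = begin
      ∣ runFrom p E (step p E F x) us ∣   ≤⟨ inert⇒∣runFrom∣≤ (step p E F x) us ⟩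
      (∣ step p E F x ∣ + length us)      ≤⟨ ℕ.+-monoˡ-≤ (length us) ∣step∣≤1+∣F∣ ⟩
      (suc ∣ F ∣ + length us)             ≡⟨ ℕ.+-suc ∣ F ∣ (length us) ⟨
      (∣ F ∣ + suc (length us))           ∎
      where
      open ℕ.≤-Reasoning
      ∣step∣≤1+∣F∣ : ∣ step p E F x ∣ ≤ suc ∣ F ∣
      ∣step∣≤1+∣F∣ = begin
        ∣ step p E F x ∣       ≤⟨ p⊆q⇒∣p∣≤∣q∣ (∪-lub (⊆-trans (inert F) (p⊆p∪q ⁅ x ⁆)) (q⊆p∪q F ⁅ x ⁆)) ⟩
        ∣ F ∪ ⁅ x ⁆ ∣          ≤⟨ ∣p∪q∣≤∣p∣+∣q∣ F ⁅ x ⁆ ⟩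
        (∣ F ∣ + ∣ ⁅ x ⁆ ∣)    ≡⟨ cong (ℕ._+_ ∣ F ∣) (∣⁅x⁆∣≡1 x) ⟩
        (∣ F ∣ + 1)            ≡⟨ ℕ.+-comm ∣ F ∣ 1 ⟩
        suc ∣ F ∣              ∎

    inert⇒n≤length : ∀ us → IsBurningSeq p E us → n ≤ length us
    inert⇒n≤length []       (_ , ⊥≡⊤) =
      ℕ.≤-reflexive (trans (sym (∣⊤∣≡n n)) (trans (cong ∣_∣ (sym ⊥≡⊤)) (∣⊥∣≡0 n)))
    inert⇒n≤length (u ∷ us) (_ , burns) = begin
      n                                  ≡⟨ ∣⊤∣≡n n ⟨
      ∣ ⊤ {n} ∣                          ≡⟨ cong ∣_∣ burns ⟨
      ∣ runFrom p E ⁅ u ⁆ us ∣           ≤⟨ inert⇒∣runFrom∣≤ ⁅ u ⁆ us ⟩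
      (∣ ⁅ u ⁆ ∣ + length us)            ≡⟨ cong (_+ length us) (∣⁅x⁆∣≡1 u) ⟩
      suc (length us)                    ∎
      where open ℕ.≤-Reasoning

    inert⇒BurningNumber≡n : Fin n → BurningNumber p E n
    inert⇒BurningNumber≡n u =
      let us , valid , burns , ∣⁅u⁆∣+∣us∣≤n = finish ⁅ u ⁆
          burning : IsBurningSeq p E (u ∷ us)
          burning = valid , burns
          1+∣us∣≤n = subst (λ m → m + length us ≤ n) (∣⁅x⁆∣≡1 u) ∣⁅u⁆∣+∣us∣≤n
      in (u ∷ us , ℕ.≤-antisym 1+∣us∣≤n (inert⇒n≤length (u ∷ us) burning) , burning) , inert⇒n≤length

  Gain : Subset n → Set
  Gain F = ∃ λ us → ValidFrom p E F us × ∣ F ∣ + length us ℕ.< ∣ runFrom p E F us ∣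

  gain-now : ∀ {F x} → x ∉ F → suc ∣ F ∣ ℕ.< ∣ step p E F x ∣ → Gain F
  gain-now {F} {x} x∉F 1+∣F∣<∣F′∣ =
    x ∷ [] , (x∉F , _) , subst (ℕ._< ∣ step p E F x ∣) (ℕ.+-comm 1 ∣ F ∣) 1+∣F∣<∣F′∣

  gain-later : ∀ {F x} → x ∉ F → Gain (step p E F x) → Gain F
  gain-later {F} {x} x∉F (us , valid , gain) = x ∷ us , (x∉F , valid) , (begin-strict
    (∣ F ∣ + suc (length us))           ≡⟨ ℕ.+-suc ∣ F ∣ (length us) ⟩
    (suc ∣ F ∣ + length us)             ≤⟨ ℕ.+-monoˡ-≤ (length us) (step-grows x∉F) ⟩
    (∣ step p E F x ∣ + length us)      <⟨ gain ⟩
    ∣ runFrom p E (step p E F x) us ∣   ∎)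
    where open ℕ.≤-Reasoning

  gain⇒short-burning-sequence : ∀ u → Gain ⁅ u ⁆ → ∃ λ us → IsBurningSeq p E us × length us ℕ.< n
  gain⇒short-burning-sequence u (us , valid , gain) =
    let vs , valid′ , burns , bound = finish (runFrom p E ⁅ u ⁆ us) in
    u ∷ us ++ vs ,
    (ValidFrom-++ ⁅ u ⁆ us vs valid valid′ , trans (runFrom-++ ⁅ u ⁆ us vs) burns) ,
    (begin-strict
      suc (length (us ++ vs))                   ≡⟨ cong suc (List.length-++ us) ⟩
      (suc (length us) + length vs)             ≡⟨ cong (λ m → m + length us + length vs) (∣⁅x⁆∣≡1 u) ⟨
      (∣ ⁅ u ⁆ ∣ + length us + length vs)       <⟨ ℕ.+-monoˡ-< (length vs) gain ⟩
      (∣ runFrom p E ⁅ u ⁆ us ∣ + length vs)    ≤⟨ bound ⟩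
      n                                         ∎)
    where open ℕ.≤-Reasoning

  module _ {e : Subset n} {j : ℕ} (e∈E : e List.∈ E) (∣e∣≡1+j : ∣ e ∣ ≡ suc j)
           (ignition : ∀ F → j ≤ ∣ e ∩ F ∣ → ignites p F e ≡ true) {o : Fin n} (o∉e : o ∉ e) where

    gain-inside-edge : ∀ F → F ⊆ e → ∣ F ∣ ≤ j → Gain F
    gain-inside-edge F F⊆e ∣F∣≤j = fill (j ∸ ∣ F ∣) F F⊆e (ℕ.m+[n∸m]≡n ∣F∣≤j)
      where
      fill : ∀ t F → F ⊆ e → ∣ F ∣ + t ≡ j → Gain F
      fill zero F F⊆e ∣F∣+0≡j = gain-now (o∉e ∘ F⊆e) (begin-strict
        suc ∣ F ∣               ≡⟨ cong suc ∣F∣≡j ⟩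
        suc j                   ≡⟨ ∣e∣≡1+j ⟨
        ∣ e ∣                   <⟨ p⊂q⇒∣p∣<∣q∣ (e⊆F′ , o , o∈F′ , o∉e) ⟩
        ∣ step p E F o ∣        ∎)
        where
        open ℕ.≤-Reasoning
        ∣F∣≡j : ∣ F ∣ ≡ j
        ∣F∣≡j = trans (sym (ℕ.+-identityʳ ∣ F ∣)) ∣F∣+0≡j
        e-ignites : ignites p F e ≡ true
        e-ignites = ignition F (subst (_≤ ∣ e ∩ F ∣) ∣F∣≡j (p⊆q⇒∣p∣≤∣q∣ λ x∈F → x∈p∩q⁺ (F⊆e x∈F , x∈F)))
        e⊆F′ : e ⊆ step p E F o
        e⊆F′ = ⊆-trans (ignites⇒⊆propagate p e∈E e-ignites) (p⊆p∪q ⁅ o ⁆)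
        o∈F′ : o ∈ step p E F o
        o∈F′ = q⊆p∪q (propagate p E F) ⁅ o ⁆ (x∈⁅x⁆ o)
      fill (suc t) F F⊆e ∣F∣+1+t≡j =
        -- either the round burns exactly F ∪ ⁅ x ⁆, still inside e, or propagation gains at once
        let x , x∈e , x∉F = ∣p∣<∣q∣⇒∃x∈q∖p ∣F∣<∣e∣
        in [ (λ F∪⁅x⁆≡F′ → gain-later x∉F (subst Gain F∪⁅x⁆≡F′
                (fill t (F ∪ ⁅ x ⁆) (∪-lub F⊆e (x∈p⇒⁅x⁆⊆p x∈e))
                  (trans (cong (_+ t) (∣p∪⁅x⁆∣≡1+∣p∣ x∉F)) (trans (sym (ℕ.+-suc ∣ F ∣ t)) ∣F∣+1+t≡j)))))
           , (λ ∣F∪⁅x⁆∣<∣F′∣ →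
                gain-now x∉F (subst (ℕ._< ∣ step p E F x ∣) (∣p∪⁅x⁆∣≡1+∣p∣ x∉F) ∣F∪⁅x⁆∣<∣F′∣))
           ]′ (⊆⇒≡⊎∣∣< (∪⁅x⁆⊆step F x))
        where
        ∣F∣<∣e∣ : ∣ F ∣ ℕ.< ∣ e ∣
        ∣F∣<∣e∣ = begin-strict
          ∣ F ∣            ≤⟨ ℕ.m≤m+n ∣ F ∣ (suc t) ⟩
          (∣ F ∣ + suc t)  ≡⟨ ∣F∣+1+t≡j ⟩
          j                <⟨ ℕ.n<1+n j ⟩
          suc j            ≡⟨ ∣e∣≡1+j ⟨
          ∣ e ∣            ∎
          where open ℕ.≤-Reasoning

¬BurningNumber≡1 : ∀ {p} {E : Hypergraph n} → 2 ≤ n → ¬ BurningNumber p E 1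
¬BurningNumber≡1 {n = n} 2≤n ((u ∷ [] , _ , _ , ⁅u⁆≡⊤) , _) =
  ℕ.<⇒≢ 2≤n (trans (sym (∣⁅x⁆∣≡1 u)) (trans (cong ∣_∣ ⁅u⁆≡⊤) (∣⊤∣≡n n)))

module _ {p : ℚ} {E : Hypergraph n} (j : ℕ) where

  above-threshold⇒Inert : Uniform (suc j) E → 1ℚ - + 1 / suc j < p → Inert p E
  above-threshold⇒Inert uniform 1-1/k<p F = propagate⊆ p E F (All.map burned-out uniform)
    where
    burned-out : ∀ {e} → ∣ e ∣ ≡ suc j → ignites p F e ≡ true → e ⊆ F
    burned-out {e} ∣e∣≡k e-ignites = ∣p∣≤∣p∩q∣⇒p⊆q (subst (_≤ ∣ e ∩ F ∣) (sym ∣e∣≡k) (ℤ.drop‿+≤+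
      (ℤ.≤-trans (1-1/k<p⇒k≤⌈p*k⌉ j p 1-1/k<p)
        (subst (λ m → ceiling (p * (+ m / 1)) ℤ.≤ + ∣ e ∩ F ∣) ∣e∣≡k
          (Equivalence.to (ignites⇔ p F e) e-ignites)))))

  below-threshold⇒ignites : ¬ (1ℚ - + 1 / suc j < p) → ∀ {e : Subset n} → ∣ e ∣ ≡ suc j →
                            ∀ F → j ≤ ∣ e ∩ F ∣ → ignites p F e ≡ true
  below-threshold⇒ignites ¬1-1/k<p {e} ∣e∣≡k F j≤∣e∩F∣ = Equivalence.from (ignites⇔ p F e)
    (subst (λ m → ceiling (p * (+ m / 1)) ℤ.≤ + ∣ e ∩ F ∣) (sym ∣e∣≡k)
      (ℤ.≤-trans (p≤1-1/k⇒⌈p*k⌉≤k-1 j p (ℚ.≮⇒≥ ¬1-1/k<p)) (ℤ.+≤+ j≤∣e∩F∣)))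

  below-threshold⇒¬BurningNumber≡n : ∀ {e o u} → e List.∈ E → ∣ e ∣ ≡ suc j → 1 ≤ j → o ∉ e → u ∈ e →
                                     ¬ (1ℚ - + 1 / suc j < p) → ¬ BurningNumber p E n
  below-threshold⇒¬BurningNumber≡n {e} {u = u} e∈E ∣e∣≡k 1≤j o∉e u∈e ¬1-1/k<p (_ , minimal) =
    let us , burning , short = gain⇒short-burning-sequence p E u
          (gain-inside-edge p E e∈E ∣e∣≡k (below-threshold⇒ignites ¬1-1/k<p {e} ∣e∣≡k) o∉e
            ⁅ u ⁆ (x∈p⇒⁅x⁆⊆p u∈e) (subst (_≤ j) (sym (∣⁅x⁆∣≡1 u)) 1≤j))
    in ℕ.<⇒≱ short (minimal us burning)

lemma3p5 : (n k : ℕ) .{{_ : NonZero k}} (E : Hypergraph n) →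
    Simple E → Uniform k E → 2 ≤ length E →
    ((p : ℚ) → 0ℚ < p → p < 1ℚ → ¬ BurningNumber p E 1)
    × ((p : ℚ) → 0ℚ < p → p < 1ℚ → (BurningNumber p E n ⇔ (1ℚ - (+ 1 / k) < p)))
lemma3p5 n zero {{()}} E
lemma3p5 n (suc j) [] _ _ ()
lemma3p5 n (suc j) (_ ∷ []) _ _ (s≤s ())
lemma3p5 n (suc j) (e ∷ e′ ∷ _) ((e≢e′ ∷ _) ∷ _ , 2≤∣e∣ ∷ _) uniform@(∣e∣≡k ∷ ∣e′∣≡k ∷ _) _
  with u , u∈e ← 0<∣p∣⇒Nonempty (ℕ.≤-trans (s≤s z≤n) 2≤∣e∣)
     | o , o∉e ← p≢q∧∣p∣≡∣q∣⇒∃x∉p e≢e′ (trans ∣e∣≡k (sym ∣e′∣≡k)) =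
    (λ p _ _ → ¬BurningNumber≡1 (ℕ.≤-trans 2≤∣e∣ (∣p∣≤n e)))
  , λ p _ _ → mk⇔
      (λ p-burns-in-n → decidable-stable (1ℚ - + 1 / suc j ℚ.<? p) λ below →
         below-threshold⇒¬BurningNumber≡n j (here refl) ∣e∣≡k 1≤j o∉e u∈e below p-burns-in-n)
      (λ above → inert⇒BurningNumber≡n p _ (above-threshold⇒Inert j uniform above) u)
  where
  1≤j : 1 ≤ j
  1≤j = ℕ.≤-pred (subst (2 ≤_) ∣e∣≡k 2≤∣e∣)
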